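{- Let $\mathfrak C$ be a type-theoretic fibration category with Reedy $\omega^{\mathrm{op}}$-limits, and let $F: F_0 \twoheadleftarrow F_1 \twoheadleftarrow F_2 \twoheadleftarrow\cdots$ be a diagram $\omega^{\mathrm{op}}\to\mathfrak C$ in which all maps are acyclic fibrations. Then for each $i$ the canonical map $\lim F\to F_i$ is a homotopy equivalence.
   Context: A type-theoretic fibration category (Shulman) is a category with terminal object and a class of fibrations (containing isomorphisms and maps to the terminal object, closed under composition, stable under pullback, with dependent products along fibrations and factorisations of diagonals of fibrations into acyclic cofibration followed by fibration); it interprets dependent type theory with $\mathbf 1,\Sigma,\Pi$ and identity types. A homotopy equivalence is a morphism that is an equivalence in the internal type-theoretic sense; an acyclic fibration is a fibration that is a homotopy equivalence. Having Reedy $\omega^{\mathrm{op}}$-limits (Shulman, Definition 11.4) means that Reedy fibrant diagrams over $\omega^{\mathrm{op}}$ (towers of fibrations) have limits, and that Reedy fibrations between such diagrams that are levelwise acyclic fibrations induce acyclic fibrations between the limits. -}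

module Defs where

open import Level using (Level; _⊔_) renaming (suc to lsuc)
open import Data.Nat using (ℕ; zero; suc)
open import Data.Product using (Σ; _×_; _,_)
open import Relation.Binary.PropositionalEquality using (_≡_)

record Category (o ℓ : Level) : Set (lsuc (o ⊔ ℓ)) where
  infixr 9 _∘_
  infix 4 _⇒_
  field
    Obj  : Set o
    _⇒_  : Obj → Obj → Set ℓ
    id   : ∀ {A} → A ⇒ A
    _∘_  : ∀ {A B C} → B ⇒ C → A ⇒ B → A ⇒ C
    identityˡ : ∀ {A B} {f : A ⇒ B} → id ∘ f ≡ f
    identityʳ : ∀ {A B} {f : A ⇒ B} → f ∘ id ≡ f
    assoc : ∀ {A B C D} {f : A ⇒ B} {g : B ⇒ C} {h : C ⇒ D} →
            (h ∘ g) ∘ f ≡ h ∘ (g ∘ f)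

module _ {o ℓ : Level} (C : Category o ℓ) where
  open Category C

  IsIso : ∀ {A B} → A ⇒ B → Set ℓ
  IsIso {A} {B} f = Σ (B ⇒ A) λ g → (g ∘ f ≡ id) × (f ∘ g ≡ id)

  record Terminal : Set (o ⊔ ℓ) where
    field
      ⊤  : Obj
      !  : ∀ {A} → A ⇒ ⊤
      !-unique : ∀ {A} (h : A ⇒ ⊤) → h ≡ !

  record Pullback {A B Z : Obj} (f : A ⇒ Z) (g : B ⇒ Z) : Set (o ⊔ ℓ) where
    field
      P  : Obj
      p₁ : P ⇒ A
      p₂ : P ⇒ B
      commute : f ∘ p₁ ≡ g ∘ p₂
      universal : ∀ {X} (h₁ : X ⇒ A) (h₂ : X ⇒ B) → f ∘ h₁ ≡ g ∘ h₂ →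
                  Σ (X ⇒ P) λ u → (p₁ ∘ u ≡ h₁) × (p₂ ∘ u ≡ h₂)
      unique : ∀ {X} (u v : X ⇒ P) → p₁ ∘ u ≡ p₁ ∘ v → p₂ ∘ u ≡ p₂ ∘ v → u ≡ v

  HasLLP : ∀ {A B E Y} → A ⇒ B → E ⇒ Y → Set ℓ
  HasLLP {A} {B} {E} {Y} i p =
    (u : A ⇒ E) (v : B ⇒ Y) → p ∘ u ≡ v ∘ i →
    Σ (B ⇒ E) λ h → (h ∘ i ≡ u) × (p ∘ h ≡ v)

-- Type-theoretic fibration categories (Shulman, Def. 2.1)

record TTFC {o ℓ : Level} (C : Category o ℓ) (r : Level) : Set (lsuc (o ⊔ ℓ ⊔ r)) where
  open Category C
  field
    terminal : Terminal C
    IsFib : ∀ {A B} → A ⇒ B → Set r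

  open Terminal terminal public

  IsAcyclicCofibration : ∀ {A B} → A ⇒ B → Set (o ⊔ ℓ ⊔ r)
  IsAcyclicCofibration i = ∀ {E Y} (p : E ⇒ Y) → IsFib p → HasLLP C i p

  field
    fib-iso  : ∀ {A B} (f : A ⇒ B) → IsIso C f → IsFib f
    fib-!    : ∀ {A} → IsFib (! {A})
    fib-∘    : ∀ {A B D} {f : A ⇒ B} {g : B ⇒ D} → IsFib g → IsFib f → IsFib (g ∘ f)
    pb       : ∀ {A B Z} (p : A ⇒ Z) → IsFib p → (f : B ⇒ Z) → Pullback C p f
    pb-fib   : ∀ {A B Z} (p : A ⇒ Z) (fp : IsFib p) (f : B ⇒ Z) →
               IsFib (Pullback.p₂ (pb p fp f))

  KernelPair : ∀ {A B} (g : A ⇒ B) → IsFib g → Pullback C g g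
  KernelPair g fg = pb g fg g

  field
    -- dependent products along fibrations: for a fibration g : A ↠ B, the
    -- pullback functor g* : C/B → C/A has a partial right adjoint Π_g
    -- defined at fibrations over A, with values fibrations over B.
    Π-obj : ∀ {A B E} (g : A ⇒ B) → IsFib g → (p : E ⇒ A) → IsFib p → Obj
    Π-map : ∀ {A B E} (g : A ⇒ B) (fg : IsFib g) (p : E ⇒ A) (fp : IsFib p) →
            Π-obj g fg p fp ⇒ B
    Π-fib : ∀ {A B E} (g : A ⇒ B) (fg : IsFib g) (p : E ⇒ A) (fp : IsFib p) →
            IsFib (Π-map g fg p fp)
    Π-ε   : ∀ {A B E} (g : A ⇒ B) (fg : IsFib g) (p : E ⇒ A) (fp : IsFib p) →
            Pullback.P (pb (Π-map g fg p fp) (Π-fib g fg p fp) g) ⇒ E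
    Π-ε-over : ∀ {A B E} (g : A ⇒ B) (fg : IsFib g) (p : E ⇒ A) (fp : IsFib p) →
            p ∘ Π-ε g fg p fp ≡ Pullback.p₂ (pb (Π-map g fg p fp) (Π-fib g fg p fp) g)
    -- universal property: for q : X → B, maps g*X → E over A correspond
    -- uniquely to maps X → Π_g p over B (via g*(-) followed by ε)
    Π-universal :
      ∀ {A B E} (g : A ⇒ B) (fg : IsFib g) (p : E ⇒ A) (fp : IsFib p)
        {X} (q : X ⇒ B) (h : Pullback.P (pb g fg q) ⇒ E) →
        p ∘ h ≡ Pullback.p₁ (pb g fg q) →
        Σ (X ⇒ Π-obj g fg p fp) λ k →
          (Π-map g fg p fp ∘ k ≡ q) ×
          (∀ (k' : Pullback.P (pb g fg q) ⇒
                   Pullback.P (pb (Π-map g fg p fp) (Π-fib g fg p fp) g)) →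
             Pullback.p₁ (pb (Π-map g fg p fp) (Π-fib g fg p fp) g) ∘ k'
               ≡ k ∘ Pullback.p₂ (pb g fg q) →
             Pullback.p₂ (pb (Π-map g fg p fp) (Π-fib g fg p fp) g) ∘ k'
               ≡ Pullback.p₁ (pb g fg q) →
             Π-ε g fg p fp ∘ k' ≡ h)
    Π-unique :
      ∀ {A B E} (g : A ⇒ B) (fg : IsFib g) (p : E ⇒ A) (fp : IsFib p)
        {X} (q : X ⇒ B) (k₁ k₂ : X ⇒ Π-obj g fg p fp) →
        Π-map g fg p fp ∘ k₁ ≡ q → Π-map g fg p fp ∘ k₂ ≡ q →
        (∀ (k₁' k₂' : Pullback.P (pb g fg q) ⇒
                   Pullback.P (pb (Π-map g fg p fp) (Π-fib g fg p fp) g)) →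
           Pullback.p₁ (pb (Π-map g fg p fp) (Π-fib g fg p fp) g) ∘ k₁'
             ≡ k₁ ∘ Pullback.p₂ (pb g fg q) →
           Pullback.p₂ (pb (Π-map g fg p fp) (Π-fib g fg p fp) g) ∘ k₁'
             ≡ Pullback.p₁ (pb g fg q) →
           Pullback.p₁ (pb (Π-map g fg p fp) (Π-fib g fg p fp) g) ∘ k₂'
             ≡ k₂ ∘ Pullback.p₂ (pb g fg q) →
           Pullback.p₂ (pb (Π-map g fg p fp) (Π-fib g fg p fp) g) ∘ k₂'
             ≡ Pullback.p₁ (pb g fg q) →
           Π-ε g fg p fp ∘ k₁' ≡ Π-ε g fg p fp ∘ k₂') →
        k₁ ≡ k₂
    -- factorisation of the diagonal  A → A ×_B A  of a fibration g : A ↠ B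
    -- as an acyclic cofibration followed by a fibration
    path-obj : ∀ {A B} (g : A ⇒ B) → IsFib g → Obj
    path-refl : ∀ {A B} (g : A ⇒ B) (fg : IsFib g) → A ⇒ path-obj g fg
    path-ends : ∀ {A B} (g : A ⇒ B) (fg : IsFib g) →
                path-obj g fg ⇒ Pullback.P (KernelPair g fg)
    path-refl-acof : ∀ {A B} (g : A ⇒ B) (fg : IsFib g) →
                     IsAcyclicCofibration (path-refl g fg)
    path-ends-fib : ∀ {A B} (g : A ⇒ B) (fg : IsFib g) → IsFib (path-ends g fg)
    path-diag₁ : ∀ {A B} (g : A ⇒ B) (fg : IsFib g) →
                 Pullback.p₁ (KernelPair g fg) ∘ (path-ends g fg ∘ path-refl g fg) ≡ id
    path-diag₂ : ∀ {A B} (g : A ⇒ B) (fg : IsFib g) →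
                 Pullback.p₂ (KernelPair g fg) ∘ (path-ends g fg ∘ path-refl g fg) ≡ id

  PathObj : Obj → Obj
  PathObj A = path-obj (! {A}) fib-!

  Homotopic : ∀ {X A} → X ⇒ A → X ⇒ A → Set ℓ
  Homotopic {X} {A} f g =
    Σ (X ⇒ PathObj A) λ H →
      (Pullback.p₁ (KernelPair (! {A}) fib-!) ∘ (path-ends (! {A}) fib-! ∘ H) ≡ f) ×
      (Pullback.p₂ (KernelPair (! {A}) fib-!) ∘ (path-ends (! {A}) fib-! ∘ H) ≡ g)

  IsHomotopyEquivalence : ∀ {A B} → A ⇒ B → Set ℓ
  IsHomotopyEquivalence {A} {B} f =
    Σ (B ⇒ A) λ g → Homotopic (g ∘ f) id × Homotopic (f ∘ g) id

  IsAcyclicFibration : ∀ {A B} → A ⇒ B → Set (ℓ ⊔ r)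
  IsAcyclicFibration f = IsFib f × IsHomotopyEquivalence f

module _ {o ℓ : Level} (C : Category o ℓ) where
  open Category C

  record Tower : Set (o ⊔ ℓ) where
    field
      F : ℕ → Obj
      d : ∀ n → F (suc n) ⇒ F n

  record Limit (T : Tower) : Set (o ⊔ ℓ) where
    open Tower T
    field
      L  : Obj
      π  : ∀ n → L ⇒ F n
      π-commute : ∀ n → d n ∘ π (suc n) ≡ π n
      universal : ∀ {X} (c : ∀ n → X ⇒ F n) → (∀ n → d n ∘ c (suc n) ≡ c n) →
                  Σ (X ⇒ L) λ u → ∀ n → π n ∘ u ≡ c n
      unique : ∀ {X} (u v : X ⇒ L) → (∀ n → π n ∘ u ≡ π n ∘ v) → u ≡ v

  record TowerMap (S T : Tower) : Set ℓ where
    private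
      module S = Tower S
      module T = Tower T
    field
      α : ∀ n → S.F n ⇒ T.F n
      natural : ∀ n → T.d n ∘ α (suc n) ≡ α n ∘ S.d n

-- Reedy ω^op-limits (Shulman, Def. 11.4)

module _ {o ℓ r : Level} {C : Category o ℓ} (𝒞 : TTFC C r) where
  open Category C
  open TTFC 𝒞

  IsReedyFibrant : Tower C → Set r
  IsReedyFibrant T = ∀ n → IsFib (Tower.d T n)

  -- Reedy fibration S → T between Reedy fibrant towers: α 0 is a fibration
  -- and each relative matching map  S (n+1) → T (n+1) ×_{T n} S n  is one.
  IsReedyFibration : ∀ {S T : Tower C} → IsReedyFibrant T → TowerMap C S T → Set (ℓ ⊔ r)
  IsReedyFibration {S} {T} fT φ =
    IsFib (α 0) ×
    (∀ n (m : S.F (suc n) ⇒ Pullback.P (pb (T.d n) (fT n) (α n))) →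
       Pullback.p₁ (pb (T.d n) (fT n) (α n)) ∘ m ≡ α (suc n) →
       Pullback.p₂ (pb (T.d n) (fT n) (α n)) ∘ m ≡ S.d n →
       IsFib m)
    where
      module S = Tower S
      module T = Tower T
      open TowerMap φ

  record HasReedyLimits : Set (lsuc (o ⊔ ℓ ⊔ r)) where
    field
      lim : (T : Tower C) → IsReedyFibrant T → Limit C T
      lim-acyclic :
        ∀ (S T : Tower C) (fS : IsReedyFibrant S) (fT : IsReedyFibrant T)
          (φ : TowerMap C S T) → IsReedyFibration fT φ →
          (∀ n → IsAcyclicFibration (TowerMap.α φ n)) →
          ∀ (u : Limit.L (lim S fS) ⇒ Limit.L (lim T fT)) →
          (∀ n → Limit.π (lim T fT) n ∘ u ≡ TowerMap.α φ n ∘ Limit.π (lim S fS) n) →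
          IsAcyclicFibration u

-- The composites Fₙ → F₀ form a tower map from F to the constant tower on F₀.
-- It is levelwise an acyclic fibration, and a Reedy fibration because its
-- relative matching maps are the dₙ up to isomorphism; so the induced map
-- lim F → lim F₀ ≅ F₀, which is π₀, is an acyclic fibration.  For i > 0 one
-- drops the first i levels of the tower.
--
-- The homotopy theory needed is that homotopy equivalences compose.  Both
-- whiskering and transitivity of homotopy come from extending homotopies along
-- acyclic cofibrations; for transitivity the acyclic cofibration is a pullback
-- of refl along a fibration, which is acyclic by the Frobenius property that
-- dependent products provide.
module Submission where

open import Level using (Level; _⊔_)
open import Data.Nat using (zero; suc)
open import Data.Product using (Σ; _×_; _,_; proj₁; proj₂)
open import Relation.Binary.PropositionalEquality
  using (_≡_; refl; sym; trans; cong; subst; subst₂; module ≡-Reasoning)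
open import Defs

module CategoryReasoning {o ℓ : Level} (C : Category o ℓ) where
  open Category C

  pullˡ : ∀ {A B D E} {f : A ⇒ B} {g : B ⇒ D} {h : D ⇒ E} {k : B ⇒ E} →
          h ∘ g ≡ k → h ∘ (g ∘ f) ≡ k ∘ f
  pullˡ {f = f} eq = trans (sym assoc) (cong (_∘ f) eq)

  pullʳ : ∀ {A B D E} {f : A ⇒ B} {g : B ⇒ D} {h : D ⇒ E} {k : A ⇒ D} →
          g ∘ f ≡ k → (h ∘ g) ∘ f ≡ h ∘ k
  pullʳ {h = h} eq = trans assoc (cong (h ∘_) eq)

  cancelˡ : ∀ {A B D} {f : A ⇒ B} {g : B ⇒ D} {h : D ⇒ B} →
            h ∘ g ≡ id → h ∘ (g ∘ f) ≡ f
  cancelˡ eq = trans (pullˡ eq) identityˡ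

  id-isIso : ∀ {A} → IsIso C (id {A})
  id-isIso = id , identityˡ , identityˡ

module _ {o ℓ : Level} {C : Category o ℓ} where
  open Category C
  open CategoryReasoning C

  pullback-of-id-p₂-isIso : ∀ {A Z} {g : A ⇒ Z} (P : Pullback C id g) → IsIso C (Pullback.p₂ P)
  pullback-of-id-p₂-isIso {g = g} P = proj₁ s , s∘p₂≡id , proj₂ (proj₂ s)
    where
      module P = Pullback P
      s = P.universal g id (trans identityˡ (sym identityʳ))
      s∘p₂≡id : proj₁ s ∘ P.p₂ ≡ id
      s∘p₂≡id = P.unique _ _
        (trans (pullˡ (proj₁ (proj₂ s))) (trans (sym P.commute) (trans identityˡ (sym identityʳ))))
        (trans (cancelˡ (proj₂ (proj₂ s))) (sym identityʳ))

  module _ {T : Tower C} (L L′ : Limit C T) where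
    private
      module L = Limit L
      module L′ = Limit L′

    comparison : L.L ⇒ L′.L
    comparison = proj₁ (L′.universal L.π L.π-commute)

    π∘comparison : ∀ n → L′.π n ∘ comparison ≡ L.π n
    π∘comparison = proj₂ (L′.universal L.π L.π-commute)

  comparison-isIso : ∀ {T} (L L′ : Limit C T) → IsIso C (comparison L L′)
  comparison-isIso L L′ = comparison L′ L , round-trip L L′ , round-trip L′ L
    where
      round-trip : ∀ {T} (L L′ : Limit C T) → comparison L′ L ∘ comparison L L′ ≡ id
      round-trip L L′ = Limit.unique L _ _ λ n →
        trans (pullˡ (π∘comparison L′ L n)) (trans (π∘comparison L L′ n) (sym identityʳ))

  module _ {S T : Tower C} (φ : TowerMap C S T) (LS : Limit C S) (LT : Limit C T) where
    private
      module S = Tower S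
      module T = Tower T
      module LS = Limit LS
      module LT = Limit LT
      open TowerMap φ

      cone-commute : ∀ n → T.d n ∘ (α (suc n) ∘ LS.π (suc n)) ≡ α n ∘ LS.π n
      cone-commute n = begin
        T.d n ∘ (α (suc n) ∘ LS.π (suc n)) ≡⟨ pullˡ (natural n) ⟩
        (α n ∘ S.d n) ∘ LS.π (suc n)       ≡⟨ pullʳ (LS.π-commute n) ⟩
        α n ∘ LS.π n                       ∎
        where open ≡-Reasoning

    limit-map : LS.L ⇒ LT.L
    limit-map = proj₁ (LT.universal (λ n → α n ∘ LS.π n) cone-commute)

    π∘limit-map : ∀ n → LT.π n ∘ limit-map ≡ α n ∘ LS.π n
    π∘limit-map = proj₂ (LT.universal (λ n → α n ∘ LS.π n) cone-commute)

  constant : Obj → Tower C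
  constant X = record { F = λ _ → X ; d = λ _ → id }

  π₀-isIso : ∀ {X} (L : Limit C (constant X)) → IsIso C (Limit.π L 0)
  π₀-isIso L = proj₁ v , L.unique _ _ v∘π₀-agrees , proj₂ v 0
    where
      module L = Limit L
      v = L.universal (λ _ → id) (λ _ → identityˡ)

      π-constant : ∀ n → L.π n ≡ L.π 0
      π-constant zero    = refl
      π-constant (suc n) = trans (sym identityˡ) (trans (L.π-commute n) (π-constant n))

      v∘π₀-agrees : ∀ n → L.π n ∘ (proj₁ v ∘ L.π 0) ≡ L.π n ∘ id
      v∘π₀-agrees n = trans (cancelˡ (proj₂ v n)) (trans (sym (π-constant n)) (sym identityʳ))

  module _ (T : Tower C) where
    open Tower T

    descend : ∀ n → F n ⇒ F 0
    descend zero    = id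
    descend (suc n) = descend n ∘ d n

    descend-map : TowerMap C T (constant (F 0))
    descend-map = record { α = descend ; natural = λ n → identityˡ }

    shift : Tower C
    shift = record { F = λ n → F (suc n) ; d = λ n → d (suc n) }

  shift-limit : ∀ {T} → Limit C T → Limit C (shift T)
  shift-limit {T} L = record
    { L = L.L
    ; π = λ n → L.π (suc n)
    ; π-commute = λ n → L.π-commute (suc n)
    ; universal = λ c commute → let u = L.universal (extend c) (extend-commute c commute)
                                in proj₁ u , λ n → proj₂ u (suc n)
    ; unique = λ u v eq → L.unique u v λ { zero → π₀-agrees u v (eq 0) ; (suc n) → eq n }
    }
    where
      open Tower T
      module L = Limit L

      extend : ∀ {X} → (∀ n → X ⇒ F (suc n)) → ∀ n → X ⇒ F n
      extend c zero    = d 0 ∘ c 0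
      extend c (suc n) = c n

      extend-commute : ∀ {X} (c : ∀ n → X ⇒ F (suc n)) → (∀ n → d (suc n) ∘ c (suc n) ≡ c n) →
                       ∀ n → d n ∘ extend c (suc n) ≡ extend c n
      extend-commute c commute zero    = refl
      extend-commute c commute (suc n) = commute n

      π₀-agrees : ∀ {X} (u v : X ⇒ L.L) → L.π 1 ∘ u ≡ L.π 1 ∘ v → L.π 0 ∘ u ≡ L.π 0 ∘ v
      π₀-agrees u v eq = begin
        L.π 0 ∘ u         ≡⟨ cong (_∘ u) (sym (L.π-commute 0)) ⟩
        (d 0 ∘ L.π 1) ∘ u ≡⟨ pullʳ eq ⟩
        d 0 ∘ (L.π 1 ∘ v) ≡⟨ pullˡ (L.π-commute 0) ⟩
        L.π 0 ∘ v         ∎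
        where open ≡-Reasoning

module _ {o ℓ r : Level} {C : Category o ℓ} (𝒞 : TTFC C r) where
  open Category C
  open CategoryReasoning C
  open TTFC 𝒞

  HasSectionExtension : ∀ {D E} → D ⇒ E → Set (o ⊔ ℓ ⊔ r)
  HasSectionExtension {D} {E} j =
    ∀ {W} (q : W ⇒ E) → IsFib q → (w : D ⇒ W) → q ∘ w ≡ j →
    Σ (E ⇒ W) λ s → (q ∘ s ≡ id) × (s ∘ j ≡ w)

  sectionExtension⇒acyclicCofibration : ∀ {D E} {j : D ⇒ E} →
                                         HasSectionExtension j → IsAcyclicCofibration j
  sectionExtension⇒acyclicCofibration {j = j} extend f f-fib u v commute =
    W.p₁ ∘ s , trans (pullʳ s∘j≡w) (proj₁ (proj₂ w)) ,
               trans (pullˡ W.commute) (trans (pullʳ q∘s≡id) identityʳ)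
    where
      module W = Pullback (pb f f-fib v)
      w = W.universal u j commute
      section = extend W.p₂ (pb-fib f f-fib v) (proj₁ w) (proj₂ (proj₂ w))
      s = proj₁ section
      q∘s≡id = proj₁ (proj₂ section)
      s∘j≡w = proj₂ (proj₂ section)

  -- A section of q extending w is obtained from a section of Π_p q extending the
  -- transpose of w along the acyclic cofibration i.
  frobenius : ∀ {E B A} (p : E ⇒ B) (p-fib : IsFib p) {i : A ⇒ B} → IsAcyclicCofibration i →
              IsAcyclicCofibration (Pullback.p₁ (pb p p-fib i))
  frobenius p p-fib {i} i-acof = sectionExtension⇒acyclicCofibration extend
    where
      module P = Pullback (pb p p-fib i)
      open ≡-Reasoning

      extend : HasSectionExtension P.p₁
      extend q q-fib w q∘w≡p₁ = s , q∘s≡id , s∘p₁≡w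
        where
          Πq = Π-map p p-fib q q-fib
          module G = Pullback (pb Πq (Π-fib p p-fib q q-fib) p)
          transpose = Π-universal p p-fib q q-fib i w q∘w≡p₁
          t = proj₁ transpose
          lift = i-acof Πq (Π-fib p p-fib q q-fib) t id
                        (trans (proj₁ (proj₂ transpose)) (sym identityˡ))
          ℓ′ = proj₁ lift
          σ = G.universal (ℓ′ ∘ p) id
                (trans (pullˡ (proj₂ (proj₂ lift))) (trans identityˡ (sym identityʳ)))
          s = Π-ε p p-fib q q-fib ∘ proj₁ σ

          q∘s≡id : q ∘ s ≡ id
          q∘s≡id = trans (pullˡ (Π-ε-over p p-fib q q-fib)) (proj₂ (proj₂ σ))

          σ∘p₁-over₁ : G.p₁ ∘ (proj₁ σ ∘ P.p₁) ≡ t ∘ P.p₂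
          σ∘p₁-over₁ = begin
            G.p₁ ∘ (proj₁ σ ∘ P.p₁) ≡⟨ pullˡ (proj₁ (proj₂ σ)) ⟩
            (ℓ′ ∘ p) ∘ P.p₁         ≡⟨ pullʳ P.commute ⟩
            ℓ′ ∘ (i ∘ P.p₂)         ≡⟨ pullˡ (proj₁ (proj₂ lift)) ⟩
            t ∘ P.p₂                ∎

          s∘p₁≡w : s ∘ P.p₁ ≡ w
          s∘p₁≡w = trans assoc
            (proj₂ (proj₂ transpose) (proj₁ σ ∘ P.p₁) σ∘p₁-over₁ (cancelˡ (proj₂ (proj₂ σ))))

  infix 4 _∼_
  _∼_ : ∀ {X A} → X ⇒ A → X ⇒ A → Set ℓ
  _∼_ = Homotopic

  ∂₀ ∂₁ : ∀ {A} → PathObj A ⇒ A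
  ∂₀ {A} = Pullback.p₁ (KernelPair (! {A}) fib-!) ∘ path-ends ! fib-!
  ∂₁ {A} = Pullback.p₂ (KernelPair (! {A}) fib-!) ∘ path-ends ! fib-!

  ∂₁-fib : ∀ {A} → IsFib (∂₁ {A})
  ∂₁-fib = fib-∘ (pb-fib ! fib-! !) (path-ends-fib ! fib-!)

  ρ : ∀ {A} → A ⇒ PathObj A
  ρ = path-refl ! fib-!

  ∂₀∘ρ : ∀ {A} → ∂₀ ∘ ρ {A} ≡ id
  ∂₀∘ρ = trans assoc (path-diag₁ ! fib-!)

  ∂₁∘ρ : ∀ {A} → ∂₁ ∘ ρ {A} ≡ id
  ∂₁∘ρ = trans assoc (path-diag₂ ! fib-!)

  homotopy : ∀ {X A} {f g : X ⇒ A} (H : X ⇒ PathObj A) → ∂₀ ∘ H ≡ f → ∂₁ ∘ H ≡ g → f ∼ g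
  homotopy H ∂₀H ∂₁H = H , trans (sym assoc) ∂₀H , trans (sym assoc) ∂₁H

  ∂₀-homotopy : ∀ {X A} {f g : X ⇒ A} (h : f ∼ g) → ∂₀ ∘ proj₁ h ≡ f
  ∂₀-homotopy (_ , ∂₀H , _) = trans assoc ∂₀H

  ∂₁-homotopy : ∀ {X A} {f g : X ⇒ A} (h : f ∼ g) → ∂₁ ∘ proj₁ h ≡ g
  ∂₁-homotopy (_ , _ , ∂₁H) = trans assoc ∂₁H

  ∼-refl : ∀ {X A} (f : X ⇒ A) → f ∼ f
  ∼-refl f = homotopy (ρ ∘ f) (cancelˡ ∂₀∘ρ) (cancelˡ ∂₁∘ρ)

  ≡⇒∼ : ∀ {X A} {f g : X ⇒ A} → f ≡ g → f ∼ g
  ≡⇒∼ {f = f} f≡g = subst (f ∼_) f≡g (∼-refl f)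

  ∼-∘ʳ : ∀ {Y X A} {f g : X ⇒ A} (k : Y ⇒ X) → f ∼ g → f ∘ k ∼ g ∘ k
  ∼-∘ʳ k h = homotopy (proj₁ h ∘ k) (pullˡ (∂₀-homotopy h)) (pullˡ (∂₁-homotopy h))

  ∼-extend : ∀ {X Y A} {i : X ⇒ Y} {a b : Y ⇒ A} → IsAcyclicCofibration i → a ∘ i ∼ b ∘ i → a ∼ b
  ∼-extend {A = A} {i} {a} {b} i-acof (H , H₀ , H₁) =
    proj₁ lift , trans (cong (K.p₁ ∘_) ends∘lift) (proj₁ (proj₂ ⟨a,b⟩)) ,
                 trans (cong (K.p₂ ∘_) ends∘lift) (proj₂ (proj₂ ⟨a,b⟩))
    where
      module K = Pullback (KernelPair (! {A}) fib-!)
      ⟨a,b⟩ = K.universal a b (trans (!-unique _) (sym (!-unique _)))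
      square : path-ends ! fib-! ∘ H ≡ proj₁ ⟨a,b⟩ ∘ i
      square = K.unique _ _ (trans H₀ (sym (pullˡ (proj₁ (proj₂ ⟨a,b⟩)))))
                            (trans H₁ (sym (pullˡ (proj₂ (proj₂ ⟨a,b⟩)))))
      lift = i-acof (path-ends ! fib-!) (path-ends-fib ! fib-!) H (proj₁ ⟨a,b⟩) square
      ends∘lift = proj₂ (proj₂ lift)

  ∼-∘ˡ : ∀ {X B D} {f g : X ⇒ B} (k : B ⇒ D) → f ∼ g → k ∘ f ∼ k ∘ g
  ∼-∘ˡ k h = subst₂ _∼_ (pullʳ (∂₀-homotopy h)) (pullʳ (∂₁-homotopy h)) (∼-∘ʳ (proj₁ h) k∘∂₀∼k∘∂₁)
    where
      k∘∂₀∼k∘∂₁ : k ∘ ∂₀ ∼ k ∘ ∂₁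
      k∘∂₀∼k∘∂₁ = ∼-extend (path-refl-acof ! fib-!)
        (subst₂ _∼_ (sym (trans (pullʳ ∂₀∘ρ) identityʳ)) (sym (trans (pullʳ ∂₁∘ρ) identityʳ))
                    (∼-refl k))

  -- Q = PA ×_A PA is the object of composable pairs of paths.  Pulling ρ back along
  -- its second projection gives an acyclic cofibration into Q along which the two
  -- outer endpoint maps of Q become homotopic, via the first path alone.
  ∼-trans : ∀ {X A} {f g h : X ⇒ A} → f ∼ g → g ∼ h → f ∼ h
  ∼-trans {A = A} f∼g g∼h =
    subst₂ _∼_ (trans (pullʳ (proj₁ (proj₂ pair))) (∂₀-homotopy f∼g))
               (trans (pullʳ (proj₂ (proj₂ pair))) (∂₁-homotopy g∼h))
               (∼-∘ʳ (proj₁ pair) composite)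
    where
      module Q = Pullback (pb (∂₁ {A}) ∂₁-fib ∂₀)
      module P = Pullback (pb Q.p₂ (pb-fib ∂₁ ∂₁-fib ∂₀) ρ)
      open ≡-Reasoning

      pair = Q.universal (proj₁ f∼g) (proj₁ g∼h) (trans (∂₁-homotopy f∼g) (sym (∂₀-homotopy g∼h)))

      endpoint : ∂₁ ∘ (Q.p₁ ∘ P.p₁) ≡ (∂₁ ∘ Q.p₂) ∘ P.p₁
      endpoint = begin
        ∂₁ ∘ (Q.p₁ ∘ P.p₁)   ≡⟨ pullˡ Q.commute ⟩
        (∂₀ ∘ Q.p₂) ∘ P.p₁   ≡⟨ pullʳ P.commute ⟩
        ∂₀ ∘ (ρ ∘ P.p₂)      ≡⟨ cancelˡ ∂₀∘ρ ⟩
        P.p₂                 ≡⟨ sym (cancelˡ ∂₁∘ρ) ⟩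
        ∂₁ ∘ (ρ ∘ P.p₂)      ≡⟨ sym (pullʳ P.commute) ⟩
        (∂₁ ∘ Q.p₂) ∘ P.p₁   ∎

      composite : ∂₀ ∘ Q.p₁ ∼ ∂₁ ∘ Q.p₂
      composite = ∼-extend (frobenius Q.p₂ (pb-fib ∂₁ ∂₁-fib ∂₀) (path-refl-acof ! fib-!))
                           (homotopy (Q.p₁ ∘ P.p₁) (sym assoc) endpoint)

  ∼-cancel-inner : ∀ {A B D} {a : A ⇒ B} {a′ : B ⇒ A} {k : B ⇒ D} {k′ : D ⇒ B} →
                   k′ ∘ k ∼ id → (a′ ∘ k′) ∘ (k ∘ a) ∼ a′ ∘ a
  ∼-cancel-inner {a = a} {a′} k′k∼id =
    subst₂ _∼_ (sym (trans assoc (cong (a′ ∘_) (sym assoc)))) (cong (a′ ∘_) identityˡ)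
               (∼-∘ˡ a′ (∼-∘ʳ a k′k∼id))

  iso⇒isHomotopyEquivalence : ∀ {A B} {f : A ⇒ B} → IsIso C f → IsHomotopyEquivalence f
  iso⇒isHomotopyEquivalence (g , g∘f≡id , f∘g≡id) = g , ≡⇒∼ g∘f≡id , ≡⇒∼ f∘g≡id

  ∘-isHomotopyEquivalence : ∀ {A B D} {f : A ⇒ B} {g : B ⇒ D} →
                            IsHomotopyEquivalence f → IsHomotopyEquivalence g →
                            IsHomotopyEquivalence (g ∘ f)
  ∘-isHomotopyEquivalence (f⁻ , f⁻f∼id , ff⁻∼id) (g⁻ , g⁻g∼id , gg⁻∼id) =
    f⁻ ∘ g⁻ , ∼-trans (∼-cancel-inner g⁻g∼id) f⁻f∼id , ∼-trans (∼-cancel-inner ff⁻∼id) gg⁻∼id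

  id-isAcyclicFibration : ∀ {A} → IsAcyclicFibration (id {A})
  id-isAcyclicFibration = fib-iso id id-isIso , iso⇒isHomotopyEquivalence id-isIso

  ∘-isAcyclicFibration : ∀ {A B D} {f : A ⇒ B} {g : B ⇒ D} →
                         IsAcyclicFibration f → IsAcyclicFibration g → IsAcyclicFibration (g ∘ f)
  ∘-isAcyclicFibration (f-fib , f-heq) (g-fib , g-heq) =
    fib-∘ g-fib f-fib , ∘-isHomotopyEquivalence f-heq g-heq

  descend-isAcyclicFibration : ∀ (F : Tower C) → (∀ n → IsAcyclicFibration (Tower.d F n)) →
                               ∀ n → IsAcyclicFibration (descend F n)
  descend-isAcyclicFibration F acyclic zero    = id-isAcyclicFibration
  descend-isAcyclicFibration F acyclic (suc n) =
    ∘-isAcyclicFibration (acyclic n) (descend-isAcyclicFibration F acyclic n)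

  constant-isReedyFibrant : ∀ {X} → IsReedyFibrant 𝒞 (constant X)
  constant-isReedyFibrant _ = fib-iso id id-isIso

  into-pullback-of-id-isFib : ∀ {X A Z} {g : A ⇒ Z} (P : Pullback C id g) {m : X ⇒ Pullback.P P} →
                              IsFib (Pullback.p₂ P ∘ m) → IsFib m
  into-pullback-of-id-isFib P p₂∘m-fib =
    subst IsFib (cancelˡ s∘p₂≡id) (fib-∘ (fib-iso s (Pullback.p₂ P , p₂∘s≡id , s∘p₂≡id)) p₂∘m-fib)
    where
      p₂-iso = pullback-of-id-p₂-isIso P
      s = proj₁ p₂-iso
      s∘p₂≡id = proj₁ (proj₂ p₂-iso)
      p₂∘s≡id = proj₂ (proj₂ p₂-iso)

  to-constant-isReedyFibration : ∀ {S : Tower C} {X} → IsReedyFibrant 𝒞 S →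
                                 (φ : TowerMap C S (constant X)) → IsFib (TowerMap.α φ 0) →
                                 IsReedyFibration 𝒞 constant-isReedyFibrant φ
  to-constant-isReedyFibration S-fib φ α₀-fib = α₀-fib , λ n m _ p₂∘m≡d →
    into-pullback-of-id-isFib (pb id (constant-isReedyFibrant n) (TowerMap.α φ n))
                              (subst IsFib (sym p₂∘m≡d) (S-fib n))

  π₀-isHomotopyEquivalence : HasReedyLimits 𝒞 → (F : Tower C) →
                             (∀ n → IsAcyclicFibration (Tower.d F n)) →
                             (L : Limit C F) → IsHomotopyEquivalence (Limit.π L 0)
  π₀-isHomotopyEquivalence reedy F acyclic L =
    subst IsHomotopyEquivalence π₀-factorisation
      (∘-isHomotopyEquivalence
        (∘-isHomotopyEquivalence (iso⇒isHomotopyEquivalence (comparison-isIso L limF))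
                                 (proj₂ u-acyclic))
        (iso⇒isHomotopyEquivalence (π₀-isIso limF₀)))
    where
      open HasReedyLimits reedy
      F-fib : IsReedyFibrant 𝒞 F
      F-fib n = proj₁ (acyclic n)
      limF = lim F F-fib
      limF₀ = lim (constant (Tower.F F 0)) constant-isReedyFibrant
      u = limit-map (descend-map F) limF limF₀
      u-acyclic : IsAcyclicFibration u
      u-acyclic = lim-acyclic F (constant (Tower.F F 0)) F-fib constant-isReedyFibrant
                    (descend-map F)
                    (to-constant-isReedyFibration F-fib (descend-map F) (fib-iso id id-isIso))
                    (descend-isAcyclicFibration F acyclic)
                    u (π∘limit-map (descend-map F) limF limF₀)
      π₀-factorisation : Limit.π limF₀ 0 ∘ (u ∘ comparison L limF) ≡ Limit.π L 0
      π₀-factorisation = trans (pullˡ (π∘limit-map (descend-map F) limF limF₀ 0))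
                               (trans (pullʳ (π∘comparison L limF 0)) identityˡ)

lemma3p5 : ∀ {o ℓ r} {C : Category o ℓ} (𝒞 : TTFC C r) → HasReedyLimits 𝒞 →
           (F : Tower C) → (∀ n → TTFC.IsAcyclicFibration 𝒞 (Tower.d F n)) →
           (L : Limit C F) → ∀ i → TTFC.IsHomotopyEquivalence 𝒞 (Limit.π L i)
lemma3p5 𝒞 reedy F acyclic L zero    = π₀-isHomotopyEquivalence 𝒞 reedy F acyclic L
lemma3p5 𝒞 reedy F acyclic L (suc i) =
  lemma3p5 𝒞 reedy (shift F) (λ n → acyclic (suc n)) (shift-limit L) i
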